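{- Let $X,Y,Z$ be finite sets and let $T\subseteq X\times Y\times Z$ be a nonempty relation such that for every $(x,y)\in X\times Y$ there exists $z\in Z$ with $(x,y,z)\in T$. Then the optimal objective value of the integer program $\mathbf{PN}(T)$ (defined in the context) equals the protocol partition number $C^P(T)$ of $M_T$.
   Context: Let $T$ be as in the claim. The communication matrix $M_T$ has rows indexed by $X$ and columns by $Y$; its cell set is $C_T=X\times Y$. A rectangle is a nonempty product $X'\times Y'\subseteq X\times Y$ (with $X',Y'$ nonempty); $\mathcal{R}(T)$ denotes the set of all rectangles and $\mathcal{R}^{\ast}(T)=\mathcal{R}(T)\setminus\{C_T\}$. A rectangle $X'\times Y'$ is monochromatic if there is $z\in Z$ with $(x,y,z)\in T$ for all $(x,y)\in X'\times Y'$; $\mathcal{M}(T)$ denotes the set of monochromatic rectangles. A partition of a rectangle $X'\times Y'$ is an unordered pair of rectangles $\{X'_1\times Y',X'_2\times Y'\}$ with $X'=X'_1\cup X'_2$, $X'_1\cap X'_2=\emptyset$, or $\{X'\times Y'_1,X'\times Y'_2\}$ with $Y'=Y'_1\cup Y'_2$, $Y'_1\cap Y'_2=\emptyset$; $\mathcal{P}(R)$ is the set of partitions of $R$, and for $P\in\mathcal{P}(R)$ we write $V\in P$ if $V$ is one of the two rectangles of $P$. Let $\Gamma(T)=\{(R,P): R\in\mathcal{R}(T),\ P\in\mathcal{P}(R)\}$. A set $\mathcal{R}$ of pairwise disjoint rectangles recursively partitions $M_T$ if its union is $C_T$ and there is a rooted binary tree whose vertices correspond to rectangles, whose root corresponds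 to $C_T$, whose leaves correspond exactly to the rectangles of $\mathcal{R}$, and such that for each non-leaf vertex the rectangles of its two children form a partition of the rectangle of that vertex. The protocol partition number $C^P(T)$ is the minimum size of a set of pairwise disjoint monochromatic rectangles that recursively partitions $M_T$. The integer program $\mathbf{PN}(T)$ has variables $x\in\mathbb{N}^{\mathcal{M}(T)}$, $y\in\mathbb{N}^{\Gamma(T)}$ ($\mathbb{N}$ the nonnegative integers) and asks to minimize $\sum_{R\in\mathcal{M}(T)}x_R$ subject to (i) $\sum_{R\in\mathcal{M}(T):\,c\in R}x_R=1$ for every $c\in C_T$, and (ii) for every $R\in\mathcal{R}^{\ast}(T)$: $\sum_{V\in\mathcal{R}(T)}\sum_{P\in\mathcal{P}(V):\,R\in P}y_{V,P}=\sum_{P\in\mathcal{P}(R)}y_{R,P}+x_R$ if $R\in\mathcal{M}(T)$, and $=\sum_{P\in\mathcal{P}(R)}y_{R,P}$ otherwise. -}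

module Defs where

import Agda.Primitive

open import Data.Nat using (ℕ; zero; suc; _+_; _≤_)
open import Data.Bool using (Bool; true; false)
import Data.Bool.Properties as BoolP
open import Data.Fin using (Fin)
open import Data.Fin.Subset using (Subset; _∈_; _∪_; _∩_; ⊥; ⊤; Nonempty)
open import Data.Fin.Subset.Properties using (_∈?_; nonempty?)
open import Data.Fin.Properties using (any?; all?)
open import Data.Vec using (Vec; []; _∷_)
open import Data.Vec.Properties using (≡-dec)
open import Data.Product.Properties using () renaming (≡-dec to ×-≡-dec)
open import Data.List using (List; []; _∷_; map; _++_; filter; cartesianProduct)
open import Data.Nat.ListAction using (sum)
open import Data.Product using (Σ; _×_; _,_; proj₁; proj₂)
open import Data.Sum using (_⊎_)
open import Data.Empty renaming (⊥ to Empty)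
open import Data.Unit using (tt) renaming (⊤ to Unit)
open import Relation.Nullary using (Dec; yes; no; ¬_)
open import Relation.Nullary.Decidable using (_×-dec_; _⊎-dec_; _→-dec_)
open import Relation.Unary using (Pred; Decidable)
open import Relation.Binary.PropositionalEquality using (_≡_)

Rel3 : ℕ → ℕ → ℕ → Set
Rel3 nx ny nz = Fin nx → Fin ny → Fin nz → Bool

_∈T_ : ∀ {nx ny nz} → Fin nx × Fin ny × Fin nz → Rel3 nx ny nz → Set
(x , y , z) ∈T T = T x y z ≡ true

allSubsets : ∀ n → List (Subset n)
allSubsets zero = [] ∷ []
allSubsets (suc n) = map (true ∷_) (allSubsets n) ++ map (false ∷_) (allSubsets n)

sumWhere : ∀ {A : Set} {P : Pred A Agda.Primitive.lzero} → Decidable P → List A → (A → ℕ) → ℕ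
sumWhere P? xs f = sum (map f (filter P? xs))

-- "The first index lying in A₁ ∪ A₂ lies in A₁" (used to pick one of the
-- two orderings of an unordered partition {A₁, A₂}).
Leads : ∀ {n} → Subset n → Subset n → Set
Leads [] [] = Empty
Leads (true ∷ _) (_ ∷ _) = Unit
Leads (false ∷ _) (true ∷ _) = Empty
Leads (false ∷ xs) (false ∷ ys) = Leads xs ys

leads? : ∀ {n} (a b : Subset n) → Dec (Leads a b)
leads? [] [] = no λ ()
leads? (true ∷ _) (_ ∷ _) = yes tt
leads? (false ∷ _) (true ∷ _) = no λ ()
leads? (false ∷ xs) (false ∷ ys) = leads? xs ys

module PN {nx ny nz : ℕ} (T : Rel3 nx ny nz) where

  Rect : Set
  Rect = Subset nx × Subset ny

  IsRect : Rect → Set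
  IsRect (A , B) = Nonempty A × Nonempty B

  full : Rect
  full = ⊤ , ⊤

  _∈R_ : Fin nx × Fin ny → Rect → Set
  (i , j) ∈R (A , B) = i ∈ A × j ∈ B

  Mono : Rect → Set
  Mono (A , B) = Σ (Fin nz) λ z → ∀ x y → x ∈ A → y ∈ B → (x , y , z) ∈T T

  RowSplit : Rect → Rect → Rect → Set
  RowSplit (A , B) (A₁ , B₁) (A₂ , B₂) =
    B₁ ≡ B × B₂ ≡ B × A₁ ∪ A₂ ≡ A × A₁ ∩ A₂ ≡ ⊥

  ColSplit : Rect → Rect → Rect → Set
  ColSplit (A , B) (A₁ , B₁) (A₂ , B₂) =
    A₁ ≡ A × A₂ ≡ A × B₁ ∪ B₂ ≡ B × B₁ ∩ B₂ ≡ ⊥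

  IsPartition : Rect → Rect → Rect → Set
  IsPartition R V W = RowSplit R V W ⊎ ColSplit R V W

  data RecPart : Rect → Set where
    leaf : ∀ {R} → Mono R → RecPart R
    node : ∀ {R V W} → IsRect V → IsRect W → IsPartition R V W →
           RecPart V → RecPart W → RecPart R

  leaves : ∀ {R} → RecPart R → ℕ
  leaves (leaf _) = 1
  leaves (node _ _ _ t u) = leaves t + leaves u

  IsProtocolPartitionNumber : ℕ → Set
  IsProtocolPartitionNumber k =
    (Σ (RecPart full) λ t → leaves t ≡ k) × (∀ (t : RecPart full) → k ≤ leaves t)

  rectDec : (R S : Rect) → Dec (R ≡ S)
  rectDec = ×-≡-dec (≡-dec BoolP._≟_) (≡-dec BoolP._≟_)

  isRect? : (R : Rect) → Dec (IsRect R)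
  isRect? (A , B) = nonempty? A ×-dec nonempty? B

  mono? : (R : Rect) → Dec (Mono R)
  mono? (A , B) = any? λ z → all? λ x → all? λ y →
    (x ∈? A) →-dec (y ∈? B) →-dec (T x y z BoolP.≟ true)

  _∈R?_ : (c : Fin nx × Fin ny) (R : Rect) → Dec (c ∈R R)
  (i , j) ∈R? (A , B) = (i ∈? A) ×-dec (j ∈? B)

  -- canonical representative of the unordered partition {V , W} of R
  -- (each element of P(R) is represented by exactly one triple (R , V , W))
  CanonPartition : Rect × Rect × Rect → Set
  CanonPartition (R , V , W) =
    (RowSplit R V W × Leads (proj₁ V) (proj₁ W)) ⊎
    (ColSplit R V W × Leads (proj₂ V) (proj₂ W))

  canon? : (g : Rect × Rect × Rect) → Dec (CanonPartition g)
  canon? ((A , B) , (A₁ , B₁) , (A₂ , B₂)) =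
    ((rectDec' B₁ B ×-dec rectDec' B₂ B ×-dec sdec (A₁ ∪ A₂) A ×-dec sdec (A₁ ∩ A₂) ⊥)
      ×-dec leads? A₁ A₂)
    ⊎-dec
    ((sdec A₁ A ×-dec sdec A₂ A ×-dec rectDec' (B₁ ∪ B₂) B ×-dec rectDec' (B₁ ∩ B₂) ⊥)
      ×-dec leads? B₁ B₂)
    where
      sdec : (a b : Subset nx) → Dec (a ≡ b)
      sdec = ≡-dec BoolP._≟_
      rectDec' : (a b : Subset ny) → Dec (a ≡ b)
      rectDec' = ≡-dec BoolP._≟_

  rects : List Rect
  rects = filter isRect? (cartesianProduct (allSubsets nx) (allSubsets ny))

  monoRects : List Rect
  monoRects = filter mono? rects

  -- Γ(T): pairs (R , P) with P ∈ P(R), P = {V , W} encoded as (R , V , W)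
  Γ : List (Rect × Rect × Rect)
  Γ = filter canon? (cartesianProduct rects (cartesianProduct rects rects))

  -- x ∈ ℕ^{M(T)} is given as a function on all candidate rectangles whose
  -- values outside M(T) are never used; likewise y ∈ ℕ^{Γ(T)}.
  objective : (Rect → ℕ) → ℕ
  objective x = sum (map x monoRects)

  Feasible : (Rect → ℕ) → (Rect × Rect × Rect → ℕ) → Set
  Feasible x y =
    (∀ (c : Fin nx × Fin ny) → sumWhere (c ∈R?_) monoRects x ≡ 1) ×
    (∀ (R : Rect) → IsRect R → ¬ (R ≡ full) →
       let inflow  = sumWhere (λ g → rectDec R (proj₁ (proj₂ g)) ⊎-dec rectDec R (proj₂ (proj₂ g))) Γ y
           outflow = sumWhere (λ g → rectDec (proj₁ g) R) Γ y
       in (Mono R → inflow ≡ outflow + x R) × (¬ Mono R → inflow ≡ outflow))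

  IsOptimalValuePN : ℕ → Set
  IsOptimalValuePN k =
    (Σ (Rect → ℕ) λ x → Σ (Rect × Rect × Rect → ℕ) λ y → Feasible x y × objective x ≡ k) ×
    (∀ x y → Feasible x y → k ≤ objective x)

module Submission where

-- Cᴾ R, the fewest leaves of a recursive partition of the rectangle R into
-- monochromatic rectangles, is computed by dynamic programming over the
-- (canonically oriented) partitions of R; it is attained and minimal.
-- Upper bound: an optimal recursive partition t of the matrix is read as a
-- solution of PN(T) (x counts the leaves, y the internal nodes); the leaves
-- cover every cell once and flow is conserved at every proper rectangle, so
-- the solution is feasible with objective Cᴾ(full).
-- Lower bound: for a feasible (x , y) and any weight w on rectangles,
-- summing constraint (ii) weighted by w over all proper rectangles and
-- exchanging the order of summation gives a balance identity.  For the
-- subadditive weight Cᴾ it yields Cᴾ(full) · out(full) ≤ objective, and for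
-- the additive weight "contains the cell c" together with constraint (i) it
-- yields out(full) = 1 (when the matrix is not itself monochromatic).

open import Data.Nat using (ℕ; zero; suc; _+_; _*_; _≤_; _<_; z≤n; s≤s; s≤s⁻¹)
open import Data.Nat.Properties
open import Algebra.Properties.CommutativeSemigroup +-commutativeSemigroup using (xy∙z≈xz∙y) renaming (interchange to +-interchange)
open import Data.Nat.ListAction using (sum)
open import Data.Nat.Tactic.RingSolver using (solve-∀)
open import Data.Bool using (Bool; true; false)
import Data.Bool.Properties as BoolP
open import Data.Fin using (Fin) renaming (_≟_ to _≟ᶠ_)
open import Data.Fin.Subset using (Subset; _∈_; _∉_; _∪_; _∩_; _─_; _-_; ⁅_⁆; ⊤; Nonempty; ∣_∣; _⊆_) renaming (⊥ to ∅)
open import Data.Fin.Subset.Properties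
open import Data.Vec using (Vec; []; _∷_; here; there)
import Data.Vec.Properties as VecP
open import Data.List using (List; []; _∷_; map; _++_; filter; cartesianProduct)
open import Data.List.Membership.Propositional using () renaming (_∈_ to _∈ᴸ_)
open import Data.List.Membership.Propositional.Properties
  using (∈-++⁺ˡ; ∈-++⁺ʳ; ∈-map⁺; ∈-filter⁺; ∈-filter⁻; ∈-cartesianProduct⁺; ∈-cartesianProduct⁻)
open import Data.List.Relation.Unary.Any using (here; there)
import Data.List.Relation.Unary.Any as Any
import Data.List.Extrema.Nat as Extrema
open import Data.Product using (Σ; _×_; _,_; proj₁; proj₂)
open import Data.Product.Properties using (,-injectiveʳ) renaming (≡-dec to ×-≡-dec)
open import Data.Sum using (_⊎_; inj₁; inj₂)
import Data.Sum
open import Data.Empty using (⊥-elim)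
open import Data.Unit using (tt)
open import Relation.Nullary using (Dec; yes; no; ¬_)
open import Relation.Nullary.Decidable using (_×-dec_; _⊎-dec_; ¬?)
open import Relation.Unary using (Pred; Decidable)
open import Relation.Binary using (DecidableEquality)
open import Relation.Binary.PropositionalEquality
open import Defs

private variable
  P Q : Set
  A B : Set

-- `when d n` is n if the decided proposition holds and 0 otherwise; every
-- sum of the program PN(T) is a sum of such indicator-weighted terms.
when : Dec P → ℕ → ℕ
when (yes _) n = n
when (no _) _ = 0

when-yes : (d : Dec P) {n : ℕ} → P → when d n ≡ n
when-yes (yes _) p = refl
when-yes (no ¬p) p = ⊥-elim (¬p p)

when-no : (d : Dec P) {n : ℕ} → ¬ P → when d n ≡ 0
when-no (yes p) ¬p = ⊥-elim (¬p p)
when-no (no _) _ = refl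

when-cong : (d : Dec P) (e : Dec Q) {n : ℕ} → (P → Q) → (Q → P) → when d n ≡ when e n
when-cong (yes p) e f g = sym (when-yes e (f p))
when-cong (no ¬p) e f g = sym (when-no e (λ q → ¬p (g q)))

when-≤ : (d : Dec P) (n : ℕ) → when d n ≤ n
when-≤ (yes _) n = ≤-refl
when-≤ (no _) n = z≤n

when-mono : (d : Dec P) {m n : ℕ} → m ≤ n → when d m ≤ when d n
when-mono (yes _) m≤n = m≤n
when-mono (no _) _ = z≤n

when-0 : (d : Dec P) → when d 0 ≡ 0
when-0 (yes _) = refl
when-0 (no _) = refl

when-+ : (d : Dec P) (m n : ℕ) → when d (m + n) ≡ when d m + when d n
when-+ (yes _) m n = refl
when-+ (no _) m n = refl

when-* : (d : Dec P) (c n : ℕ) → c * when d n ≡ when d (c * n)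
when-* (yes _) c n = refl
when-* (no _) c n = *-zeroʳ c

when-1-* : (d : Dec P) (n : ℕ) → when d 1 * n ≡ when d n
when-1-* (yes _) n = *-identityˡ n
when-1-* (no _) n = refl

when-comm : (d : Dec P) (e : Dec Q) (n : ℕ) → when d (when e n) ≡ when e (when d n)
when-comm (yes _) (yes _) n = refl
when-comm (yes _) (no _) n = refl
when-comm (no _) (yes _) n = refl
when-comm (no _) (no _) n = refl

when-× : (d : Dec P) (e : Dec Q) (n : ℕ) → when (d ×-dec e) n ≡ when d (when e n)
when-× (yes _) (yes _) n = refl
when-× (yes _) (no _) n = refl
when-× (no _) (yes _) n = refl
when-× (no _) (no _) n = refl

when-⊎ : (d : Dec P) (e : Dec Q) → ¬ (P × Q) → ∀ n → when (d ⊎-dec e) n ≡ when d n + when e n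
when-⊎ (yes p) (yes q) excl n = ⊥-elim (excl (p , q))
when-⊎ (yes _) (no _) excl n = sym (+-identityʳ n)
when-⊎ (no _) (yes _) excl n = refl
when-⊎ (no _) (no _) excl n = refl

∑ : List A → (A → ℕ) → ℕ
∑ L f = sum (map f L)

∑-ext : (L : List A) {f g : A → ℕ} → (∀ a → a ∈ᴸ L → f a ≡ g a) → ∑ L f ≡ ∑ L g
∑-ext [] h = refl
∑-ext (a ∷ L) h = cong₂ _+_ (h a (here refl)) (∑-ext L (λ b b∈L → h b (there b∈L)))

∑-mono : (L : List A) {f g : A → ℕ} → (∀ a → a ∈ᴸ L → f a ≤ g a) → ∑ L f ≤ ∑ L g
∑-mono [] h = z≤n
∑-mono (a ∷ L) h = +-mono-≤ (h a (here refl)) (∑-mono L (λ b b∈L → h b (there b∈L)))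

∑-zero : (L : List A) {f : A → ℕ} → (∀ a → f a ≡ 0) → ∑ L f ≡ 0
∑-zero [] h = refl
∑-zero (a ∷ L) h = cong₂ _+_ (h a) (∑-zero L h)

∑-+ : (L : List A) (f g : A → ℕ) → ∑ L (λ a → f a + g a) ≡ ∑ L f + ∑ L g
∑-+ [] f g = refl
∑-+ (a ∷ L) f g = trans (cong (f a + g a +_) (∑-+ L f g)) (+-interchange (f a) (g a) (∑ L f) (∑ L g))

∑-*ˡ : (L : List A) (c : ℕ) (f : A → ℕ) → ∑ L (λ a → c * f a) ≡ c * ∑ L f
∑-*ˡ [] c f = sym (*-zeroʳ c)
∑-*ˡ (a ∷ L) c f = trans (cong (c * f a +_) (∑-*ˡ L c f)) (sym (*-distribˡ-+ c (f a) (∑ L f)))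

∑-++ : (L M : List A) (f : A → ℕ) → ∑ (L ++ M) f ≡ ∑ L f + ∑ M f
∑-++ [] M f = refl
∑-++ (a ∷ L) M f = trans (cong (f a +_) (∑-++ L M f)) (sym (+-assoc (f a) _ _))

∑-when-+ : {P : A → Set} (d : ∀ a → Dec (P a)) (L : List A) (f g : A → ℕ) →
           ∑ L (λ a → when (d a) (f a + g a)) ≡ ∑ L (λ a → when (d a) (f a)) + ∑ L (λ a → when (d a) (g a))
∑-when-+ d L f g = trans (∑-ext L (λ a _ → when-+ (d a) (f a) (g a))) (∑-+ L _ _)

sumWhere-∑ : {P : Pred A _} (P? : Decidable P) (L : List A) (f : A → ℕ) →
             sumWhere P? L f ≡ ∑ L (λ a → when (P? a) (f a))
sumWhere-∑ P? [] f = refl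
sumWhere-∑ P? (a ∷ L) f with P? a
... | yes _ = cong (f a +_) (sumWhere-∑ P? L f)
... | no _ = sumWhere-∑ P? L f

when-∑ : (d : Dec P) (L : List A) (f : A → ℕ) → when d (∑ L f) ≡ ∑ L (λ a → when d (f a))
when-∑ (yes _) L f = refl
when-∑ (no _) L f = sym (∑-zero L (λ _ → refl))

∑-map : (g : A → B) (L : List A) (f : B → ℕ) → ∑ (map g L) f ≡ ∑ L (λ a → f (g a))
∑-map g [] f = refl
∑-map g (a ∷ L) f = cong (f (g a) +_) (∑-map g L f)

∑-swap : (L : List A) (M : List B) (h : A → B → ℕ) →
         ∑ L (λ a → ∑ M (h a)) ≡ ∑ M (λ b → ∑ L (λ a → h a b))
∑-swap [] M h = sym (∑-zero M (λ _ → refl))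
∑-swap (a ∷ L) M h = trans (cong (∑ M (h a) +_) (∑-swap L M h)) (sym (∑-+ M (h a) (λ b → ∑ L (λ a' → h a' b))))

∑-cartesianProduct : (L : List A) (M : List B) (h : A × B → ℕ) →
                     ∑ (cartesianProduct L M) h ≡ ∑ L (λ a → ∑ M (λ b → h (a , b)))
∑-cartesianProduct [] M h = refl
∑-cartesianProduct (a ∷ L) M h = trans (∑-++ (map (a ,_) M) (cartesianProduct L M) h)
  (cong₂ _+_ (∑-map (a ,_) M h) (∑-cartesianProduct L M h))

-- `a₀` occurs exactly once in `L`: summing over L the terms at (elements
-- equal to) a₀ picks out the single term h a₀.
OccursOnce : {A : Set} → List A → A → Set
OccursOnce {A} L a₀ = ∀ (d : (a : A) → Dec (a ≡ a₀)) (h : A → ℕ) → ∑ L (λ a → when (d a) (h a)) ≡ h a₀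

once-filter : {P : Pred A _} (P? : Decidable P) (L : List A) {a₀ : A} →
              P a₀ → OccursOnce L a₀ → OccursOnce (filter P? L) a₀
once-filter P? L {a₀} pa₀ once d h = begin
  sumWhere P? L (λ a → when (d a) (h a))         ≡⟨ sumWhere-∑ P? L _ ⟩
  ∑ L (λ a → when (P? a) (when (d a) (h a)))     ≡⟨ ∑-ext L (λ a _ → drop-filter a (d a)) ⟩
  ∑ L (λ a → when (d a) (h a))                   ≡⟨ once d h ⟩
  h a₀                                           ∎
  where
  open ≡-Reasoning
  drop-filter : ∀ a (e : Dec (a ≡ a₀)) → when (P? a) (when e (h a)) ≡ when e (h a)
  drop-filter a (yes refl) = when-yes (P? a) pa₀
  drop-filter a (no _) = when-0 (P? a)

absent-map : (f : A → B) (L : List A) {b₀ : B} → (∀ a → f a ≢ b₀) →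
             ∀ (d : (b : B) → Dec (b ≡ b₀)) (h : B → ℕ) → ∑ (map f L) (λ b → when (d b) (h b)) ≡ 0
absent-map f L f≢b₀ d h = trans (∑-map f L _) (∑-zero L (λ a → when-no (d (f a)) (f≢b₀ a)))

once-map : (f : A → B) → (∀ {a a′} → f a ≡ f a′ → a ≡ a′) →
           (L : List A) {a₀ : A} → OccursOnce L a₀ → OccursOnce (map f L) (f a₀)
once-map f f-inj L {a₀} once d h =
  trans (∑-map f L _) (trans (∑-ext L (λ a _ → when-cong (d (f a)) (d′ a) f-inj (cong f))) (once d′ (λ a → h (f a))))
  where
  d′ : ∀ a → Dec (a ≡ a₀)
  d′ a with d (f a)
  ... | yes fa≡fa₀ = yes (f-inj fa≡fa₀)
  ... | no fa≢fa₀ = no (λ a≡a₀ → fa≢fa₀ (cong f a≡a₀))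

once-cartesianProduct : DecidableEquality A → (L : List A) (M : List B) {a₀ : A} {b₀ : B} →
                        OccursOnce L a₀ → OccursOnce M b₀ → OccursOnce (cartesianProduct L M) (a₀ , b₀)
once-cartesianProduct _≟_ L M {a₀} {b₀} onceL onceM d h =
  trans (∑-cartesianProduct L M (λ ab → when (d ab) (h ab))) (trans (∑-ext L (λ a _ → row a (a ≟ a₀))) (onceL (_≟ a₀) (λ a → h (a , b₀))))
  where
  row : ∀ a → (e : Dec (a ≡ a₀)) → ∑ M (λ b → when (d (a , b)) (h (a , b))) ≡ when e (h (a , b₀))
  row a (yes refl) = trans (sym (∑-map (a₀ ,_) M _)) (once-map (a₀ ,_) ,-injectiveʳ M onceM d h)
  row a (no a≢a₀) = trans (sym (∑-map (a ,_) M _)) (absent-map (a ,_) M (λ b ab≡ → a≢a₀ (cong proj₁ ab≡)) d h)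

once-allSubsets : ∀ n (s : Vec Bool n) → OccursOnce (allSubsets n) s
once-allSubsets zero [] d h with d []
... | yes _ = +-identityʳ (h [])
... | no []≢[] = ⊥-elim ([]≢[] refl)
-- (a subset with head b is found once among those with head b, never among the others)
once-allSubsets (suc n) (true ∷ s) d h =
  trans (∑-++ (map (true ∷_) L) (map (false ∷_) L) (λ t → when (d t) (h t)))
    (trans (cong₂ _+_ (once-map (true ∷_) VecP.∷-injectiveʳ L (once-allSubsets n s) d h)
                      (absent-map (false ∷_) L (λ _ ()) d h))
           (+-identityʳ _))
  where
  L : List (Vec Bool n)
  L = allSubsets n
once-allSubsets (suc n) (false ∷ s) d h =
  trans (∑-++ (map (true ∷_) L) (map (false ∷_) L) (λ t → when (d t) (h t)))
    (cong₂ _+_ (absent-map (true ∷_) L (λ _ ()) d h)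
               (once-map (false ∷_) VecP.∷-injectiveʳ L (once-allSubsets n s) d h))
  where
  L : List (Vec Bool n)
  L = allSubsets n

∈-allSubsets : ∀ n (s : Vec Bool n) → s ∈ᴸ allSubsets n
∈-allSubsets zero [] = here refl
∈-allSubsets (suc n) (true ∷ s) = ∈-++⁺ˡ (∈-map⁺ (true ∷_) (∈-allSubsets n s))
∈-allSubsets (suc n) (false ∷ s) = ∈-++⁺ʳ (map (true ∷_) (allSubsets n)) (∈-map⁺ (false ∷_) (∈-allSubsets n s))

-- the least value of f over a list (0 for the empty list), attained by argmin
cheapest : (A → ℕ) → List A → ℕ
cheapest f [] = 0
cheapest f (a ∷ L) = f (Extrema.argmin f a L)

module _ (f : A → ℕ) where

  cheapest-≤ : ∀ {L a} → a ∈ᴸ L → cheapest f L ≤ f a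
  cheapest-≤ {b ∷ L} (here refl) = Extrema.f[argmin]≤f[⊤] {f = f} b L
  cheapest-≤ {b ∷ L} (there a∈L) = Extrema.f[argmin]≤v⁺ b L (inj₂ (Any.map (λ { refl → ≤-refl }) a∈L))

  cheapest-attained : ∀ {L a} → a ∈ᴸ L → Σ A λ b → b ∈ᴸ L × f b ≡ cheapest f L
  cheapest-attained {b ∷ L} _ with Extrema.argmin-sel f b L
  ... | inj₁ min≡b = b , here refl , cong f (sym min≡b)
  ... | inj₂ min∈L = Extrema.argmin f b L , there min∈L , refl

private variable
  n : ℕ
  i : Fin n
  U U₁ U₂ : Subset n

disjoint : U₁ ∩ U₂ ≡ ∅ → i ∈ U₁ → i ∉ U₂
disjoint {i = i} U₁∩U₂≡∅ i∈U₁ i∈U₂ = ∉⊥ (subst (i ∈_) U₁∩U₂≡∅ (x∈p∩q⁺ (i∈U₁ , i∈U₂)))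

when-∪ : U₁ ∩ U₂ ≡ ∅ → ∀ i m → when (i ∈? U₁) m + when (i ∈? U₂) m ≡ when (i ∈? (U₁ ∪ U₂)) m
when-∪ {U₁ = U₁} {U₂} U₁∩U₂≡∅ i m = begin
  when (i ∈? U₁) m + when (i ∈? U₂) m     ≡⟨ when-⊎ (i ∈? U₁) (i ∈? U₂) (λ (p , q) → disjoint U₁∩U₂≡∅ p q) m ⟨
  when (i ∈? U₁ ⊎-dec i ∈? U₂) m          ≡⟨ when-cong (i ∈? U₁ ⊎-dec i ∈? U₂) (i ∈? (U₁ ∪ U₂)) x∈p∪q⁺ (x∈p∪q⁻ U₁ U₂) ⟩
  when (i ∈? (U₁ ∪ U₂)) m                 ∎
  where open ≡-Reasoning

disjoint-distinct : U₁ ∩ U₂ ≡ ∅ → Nonempty U₁ → U₁ ≢ U₂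
disjoint-distinct U₁∩U₂≡∅ (i , i∈U₁) refl = disjoint U₁∩U₂≡∅ i∈U₁ i∈U₁

disjoint-proper : U₁ ∩ U₂ ≡ ∅ → Nonempty U₂ → U₁ ≢ ⊤
disjoint-proper U₁∩U₂≡∅ (i , i∈U₂) refl = disjoint U₁∩U₂≡∅ ∈⊤ i∈U₂

disjoint-smaller : U₁ ∩ U₂ ≡ ∅ → Nonempty U₂ → ∣ U₁ ∣ < ∣ U₁ ∪ U₂ ∣
disjoint-smaller {U₂ = U₂} U₁∩U₂≡∅ (i , i∈U₂) =
  p⊂q⇒∣p∣<∣q∣ (p⊆p∪q U₂ , i , x∈p∪q⁺ (inj₂ i∈U₂) , λ i∈U₁ → disjoint U₁∩U₂≡∅ i∈U₁ i∈U₂)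

leads-swap : (a₁ a₂ : Subset n) → Nonempty a₁ → ¬ Leads a₁ a₂ → Leads a₂ a₁
leads-swap (true ∷ a₁) (_ ∷ a₂) _ ¬leads = ⊥-elim (¬leads tt)
leads-swap (false ∷ a₁) (true ∷ a₂) _ _ = tt
leads-swap (false ∷ a₁) (false ∷ a₂) (Fin.suc i , there i∈a₁) ¬leads = leads-swap a₁ a₂ (i , i∈a₁) ¬leads

∈─⇒∉ : (p q : Subset n) → i ∈ p ─ q → i ∉ q
∈─⇒∉ (true ∷ p) (false ∷ q) here = λ ()
∈─⇒∉ (_ ∷ p) (false ∷ q) (there i∈p─q) = λ { (there i∈q) → ∈─⇒∉ p q i∈p─q i∈q }
∈─⇒∉ (_ ∷ p) (true ∷ q) (there i∈p─q) = λ { (there i∈q) → ∈─⇒∉ p q i∈p─q i∈q }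

split-off : i ∈ U → ⁅ i ⁆ ∪ (U - i) ≡ U
split-off {i = i} {U = U} i∈U = ⊆-antisym ∪⊆U U⊆∪
  where
  ∪⊆U : ⁅ i ⁆ ∪ (U - i) ⊆ U
  ∪⊆U {x} x∈∪ with x∈p∪q⁻ ⁅ i ⁆ (U - i) x∈∪
  ... | inj₁ x∈⁅i⁆ = subst (_∈ U) (sym (x∈⁅y⁆⇒x≡y i x∈⁅i⁆)) i∈U
  ... | inj₂ x∈U-i = p─q⊆p U ⁅ i ⁆ x∈U-i
  U⊆∪ : U ⊆ ⁅ i ⁆ ∪ (U - i)
  U⊆∪ {x} x∈U with x ≟ᶠ i
  ... | yes refl = x∈p∪q⁺ (inj₁ (x∈⁅x⁆ x))
  ... | no x≢i = x∈p∪q⁺ (inj₂ (x∈p∧x≢y⇒x∈p-y x∈U x≢i))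

split-off-disjoint : ∀ (i : Fin n) U → ⁅ i ⁆ ∩ (U - i) ≡ ∅
split-off-disjoint i U = Empty-unique λ (x , x∈∩) →
  let (x∈⁅i⁆ , x∈U-i) = x∈p∩q⁻ ⁅ i ⁆ (U - i) x∈∩ in ∈─⇒∉ U ⁅ i ⁆ x∈U-i x∈⁅i⁆

only-element : ¬ Nonempty (U - i) → ∀ {x} → x ∈ U → x ≡ i
only-element {i = i} nothing-left {x} x∈U with x ≟ᶠ i
... | yes x≡i = x≡i
... | no x≢i = ⊥-elim (nothing-left (x , x∈p∧x≢y⇒x∈p-y x∈U x≢i))

module Rectangles {nx ny nz : ℕ} (T : Rel3 nx ny nz) where
  open PN T

  Rect3 : Set
  Rect3 = Rect × Rect × Rect

  root left right : Rect3 → Rect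
  root g = proj₁ g
  left g = proj₁ (proj₂ g)
  right g = proj₂ (proj₂ g)

  rect3Dec : (g h : Rect3) → Dec (g ≡ h)
  rect3Dec = ×-≡-dec rectDec (×-≡-dec rectDec rectDec)

  child? : (S : Rect) (g : Rect3) → Dec (S ≡ left g ⊎ S ≡ right g)
  child? S g = rectDec S (left g) ⊎-dec rectDec S (right g)

  -- the number of rows plus columns; it strictly decreases along partitions
  size : Rect → ℕ
  size (A , B) = ∣ A ∣ + ∣ B ∣

  size-≤ : ∀ R → size R ≤ nx + ny
  size-≤ (A , B) = +-mono-≤ (∣p∣≤n A) (∣p∣≤n B)

  private variable R V W S : Rect

  row-swap : RowSplit R V W → RowSplit R W V
  row-swap {A , B} {A₁ , .B} {A₂ , .B} (refl , refl , refl , A₁∩A₂≡∅) =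
    refl , refl , ∪-comm A₂ A₁ , trans (∩-comm A₂ A₁) A₁∩A₂≡∅

  col-swap : ColSplit R V W → ColSplit R W V
  col-swap {A , B} {.A , B₁} {.A , B₂} (refl , refl , refl , B₁∩B₂≡∅) =
    refl , refl , ∪-comm B₂ B₁ , trans (∩-comm B₂ B₁) B₁∩B₂≡∅

  part-swap : IsPartition R V W → IsPartition R W V
  part-swap = Data.Sum.map row-swap col-swap

  cell-additive : IsPartition R V W → ∀ c m → when (c ∈R? V) m + when (c ∈R? W) m ≡ when (c ∈R? R) m
  cell-additive {A , B} {A₁ , .B} {A₂ , .B} (inj₁ (refl , refl , refl , A₁∩A₂≡∅)) (i , j) m = begin
    when (i ∈? A₁ ×-dec j ∈? B) m + when (i ∈? A₂ ×-dec j ∈? B) m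
      ≡⟨ cong₂ _+_ (when-× (i ∈? A₁) (j ∈? B) m) (when-× (i ∈? A₂) (j ∈? B) m) ⟩
    when (i ∈? A₁) (when (j ∈? B) m) + when (i ∈? A₂) (when (j ∈? B) m)
      ≡⟨ when-∪ A₁∩A₂≡∅ i (when (j ∈? B) m) ⟩
    when (i ∈? (A₁ ∪ A₂)) (when (j ∈? B) m)
      ≡⟨ when-× (i ∈? (A₁ ∪ A₂)) (j ∈? B) m ⟨
    when (i ∈? (A₁ ∪ A₂) ×-dec j ∈? B) m ∎
    where open ≡-Reasoning
  cell-additive {A , B} {.A , B₁} {.A , B₂} (inj₂ (refl , refl , refl , B₁∩B₂≡∅)) (i , j) m = begin
    when (i ∈? A ×-dec j ∈? B₁) m + when (i ∈? A ×-dec j ∈? B₂) m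
      ≡⟨ cong₂ _+_ (when-× (i ∈? A) (j ∈? B₁) m) (when-× (i ∈? A) (j ∈? B₂) m) ⟩
    when (i ∈? A) (when (j ∈? B₁) m) + when (i ∈? A) (when (j ∈? B₂) m)
      ≡⟨ when-+ (i ∈? A) _ _ ⟨
    when (i ∈? A) (when (j ∈? B₁) m + when (j ∈? B₂) m)
      ≡⟨ cong (when (i ∈? A)) (when-∪ B₁∩B₂≡∅ j m) ⟩
    when (i ∈? A) (when (j ∈? (B₁ ∪ B₂)) m)
      ≡⟨ when-× (i ∈? A) (j ∈? (B₁ ∪ B₂)) m ⟨
    when (i ∈? A ×-dec j ∈? (B₁ ∪ B₂)) m ∎
    where open ≡-Reasoning

  children-distinct : IsPartition R V W → IsRect V → V ≢ W
  children-distinct {V = A₁ , _} (inj₁ (_ , _ , _ , A₁∩A₂≡∅)) (neA₁ , _) V≡W =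
    disjoint-distinct A₁∩A₂≡∅ neA₁ (cong proj₁ V≡W)
  children-distinct {V = _ , B₁} (inj₂ (_ , _ , _ , B₁∩B₂≡∅)) (_ , neB₁) V≡W =
    disjoint-distinct B₁∩B₂≡∅ neB₁ (cong proj₂ V≡W)

  child-proper : IsPartition R V W → IsRect W → V ≢ full
  child-proper (inj₁ (_ , _ , _ , A₁∩A₂≡∅)) (neA₂ , _) V≡full = disjoint-proper A₁∩A₂≡∅ neA₂ (cong proj₁ V≡full)
  child-proper (inj₂ (_ , _ , _ , B₁∩B₂≡∅)) (_ , neB₂) V≡full = disjoint-proper B₁∩B₂≡∅ neB₂ (cong proj₂ V≡full)

  child-smaller : IsPartition R V W → IsRect W → size V < size R
  child-smaller {A , B} {A₁ , .B} {A₂ , .B} (inj₁ (refl , refl , refl , A₁∩A₂≡∅)) (neA₂ , _) =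
    +-monoˡ-< ∣ B ∣ (disjoint-smaller A₁∩A₂≡∅ neA₂)
  child-smaller {A , B} {.A , B₁} {.A , B₂} (inj₂ (refl , refl , refl , B₁∩B₂≡∅)) (_ , neB₂) =
    +-monoʳ-< ∣ A ∣ (disjoint-smaller B₁∩B₂≡∅ neB₂)

  canonical⇒partition : ∀ {g} → CanonPartition g → IsPartition (root g) (left g) (right g)
  canonical⇒partition (inj₁ (rs , _)) = inj₁ rs
  canonical⇒partition (inj₂ (cs , _)) = inj₂ cs

  Arranges : Rect3 → Rect → Rect → Rect → Set
  Arranges g R V W = g ≡ (R , V , W) ⊎ g ≡ (R , W , V)

  -- The unordered partition {V , W} of R is represented in Γ by exactly one
  -- of the two orderings (R , V , W) and (R , W , V).
  record Orientation (R V W : Rect) : Set where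
    field
      branch : Rect3
      canonical : CanonPartition branch
      ordering : Arranges branch R V W

  orient : IsPartition R V W → IsRect V → Orientation R V W
  orient {R} {A₁ , B₁} {A₂ , B₂} (inj₁ rs) (neA₁ , _) with leads? A₁ A₂
  ... | yes l = record { canonical = inj₁ (rs , l) ; ordering = inj₁ refl }
  ... | no ¬l = record { canonical = inj₁ (row-swap rs , leads-swap A₁ A₂ neA₁ ¬l) ; ordering = inj₂ refl }
  orient {R} {A₁ , B₁} {A₂ , B₂} (inj₂ cs) (_ , neB₁) with leads? B₁ B₂
  ... | yes l = record { canonical = inj₂ (cs , l) ; ordering = inj₁ refl }
  ... | no ¬l = record { canonical = inj₂ (col-swap cs , leads-swap B₁ B₂ neB₁ ¬l) ; ordering = inj₂ refl }

  child?-split : ∀ {g} → left g ≢ right g → ∀ S m →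
                 when (child? S g) m ≡ when (rectDec S (left g)) m + when (rectDec S (right g)) m
  child?-split V≢W S m = when-⊎ (rectDec S _) (rectDec S _) (λ (S≡V , S≡W) → V≢W (trans (sym S≡V) S≡W)) m

  module _ {g : Rect3} where

    arranges-root : Arranges g R V W → root g ≡ R
    arranges-root (inj₁ refl) = refl
    arranges-root (inj₂ refl) = refl

    arranges-children : Arranges g R V W → (w : Rect → ℕ) → w (left g) + w (right g) ≡ w V + w W
    arranges-children (inj₁ refl) w = refl
    arranges-children {V = V} {W} (inj₂ refl) w = +-comm (w W) (w V)

    arranges-child? : Arranges g R V W → V ≢ W → ∀ S m →
                      when (child? S g) m ≡ when (rectDec S V) m + when (rectDec S W) m
    arranges-child? {R = R} {V} {W} (inj₁ refl) V≢W S m = child?-split {R , V , W} V≢W S m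
    arranges-child? {R = R} {V} {W} (inj₂ refl) V≢W S m =
      trans (child?-split {R , W , V} (λ W≡V → V≢W (sym W≡V)) S m) (+-comm (when (rectDec S W) m) (when (rectDec S V) m))

  private
    subsetPairs : List Rect
    subsetPairs = cartesianProduct (allSubsets nx) (allSubsets ny)

  rect∈rects : IsRect R → R ∈ᴸ rects
  rect∈rects {A , B} isRect =
    ∈-filter⁺ isRect? (∈-cartesianProduct⁺ (∈-allSubsets nx A) (∈-allSubsets ny B)) isRect

  rects⇒rect : R ∈ᴸ rects → IsRect R
  rects⇒rect R∈rects = proj₂ (∈-filter⁻ isRect? {xs = subsetPairs} R∈rects)

  once-rects : IsRect R → OccursOnce rects R
  once-rects {A , B} isRect = once-filter isRect? subsetPairs isRect
    (once-cartesianProduct (VecP.≡-dec BoolP._≟_) (allSubsets nx) (allSubsets ny) (once-allSubsets nx A) (once-allSubsets ny B))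

  once-monoRects : IsRect R → Mono R → OccursOnce monoRects R
  once-monoRects isRect mono = once-filter mono? rects mono (once-rects isRect)

  record IsBranch (g : Rect3) : Set where
    field
      canonical : CanonPartition g
      rootRect : IsRect (root g)
      leftRect : IsRect (left g)
      rightRect : IsRect (right g)

    partition : IsPartition (root g) (left g) (right g)
    partition = canonical⇒partition canonical

  private
    triples : List Rect3
    triples = cartesianProduct rects (cartesianProduct rects rects)

  branch∈Γ : ∀ {g} → IsBranch g → g ∈ᴸ Γ
  branch∈Γ b = ∈-filter⁺ canon? (∈-cartesianProduct⁺ (rect∈rects rootRect)
                  (∈-cartesianProduct⁺ (rect∈rects leftRect) (rect∈rects rightRect))) canonical
    where open IsBranch b

  Γ⇒branch : ∀ {g} → g ∈ᴸ Γ → IsBranch g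
  Γ⇒branch {R , V , W} g∈Γ =
    let (g∈triples , canonical) = ∈-filter⁻ canon? {xs = triples} g∈Γ
        (R∈ , VW∈) = ∈-cartesianProduct⁻ rects (cartesianProduct rects rects) g∈triples
        (V∈ , W∈) = ∈-cartesianProduct⁻ rects rects VW∈
    in record { canonical = canonical ; rootRect = rects⇒rect R∈ ; leftRect = rects⇒rect V∈ ; rightRect = rects⇒rect W∈ }

  once-Γ : ∀ {g} → IsBranch g → OccursOnce Γ g
  once-Γ {R , V , W} b = once-filter canon? triples canonical
    (once-cartesianProduct rectDec rects (cartesianProduct rects rects) (once-rects rootRect)
      (once-cartesianProduct rectDec rects rects (once-rects leftRect) (once-rects rightRect)))
    where open IsBranch b

  orient-isBranch : (p : IsPartition R V W) (isV : IsRect V) → IsRect R → IsRect W →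
                    IsBranch (Orientation.branch (orient p isV))
  orient-isBranch p isV isR isW with orient p isV
  ... | record { canonical = c ; ordering = inj₁ refl } = record { canonical = c ; rootRect = isR ; leftRect = isV ; rightRect = isW }
  ... | record { canonical = c ; ordering = inj₂ refl } = record { canonical = c ; rootRect = isR ; leftRect = isW ; rightRect = isV }

  -- The flow of a weighting y of Γ through S: the total weight of the elements
  -- of Γ having S as a child, resp. as their root (the two sides of (ii)).
  inflow outflow : (Rect3 → ℕ) → Rect → ℕ
  inflow y S = ∑ Γ (λ g → when (child? S g) (y g))
  outflow y S = ∑ Γ (λ g → when (rectDec (root g) S) (y g))

module Protocol {nx ny nz : ℕ} (T : Rel3 nx ny nz) where
  open PN T
  open Rectangles T

  Total : Set
  Total = ∀ (x : Fin nx) (y : Fin ny) → Σ (Fin nz) λ z → (x , y , z) ∈T T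

  private variable R : Rect

  record Split (R : Rect) : Set where
    field
      {leftPart rightPart} : Rect
      partition : IsPartition R leftPart rightPart
      leftRect : IsRect leftPart
      rightRect : IsRect rightPart

  -- For total T every non-monochromatic rectangle A × B can be split: split off
  -- one row i ∈ A, or else one column j ∈ B; if neither is possible, A × B is
  -- the single cell (i , j), which is monochromatic.
  split : Total → IsRect R → ¬ Mono R → Split R
  split {A , B} total ((i , i∈A) , (j , j∈B)) ¬mono with nonempty? (A - i) | nonempty? (B - j)
  ... | yes rest | _ = record
    { partition = inj₁ (refl , refl , split-off i∈A , split-off-disjoint i A)
    ; leftRect = (i , x∈⁅x⁆ i) , (j , j∈B) ; rightRect = rest , (j , j∈B) }
  ... | no _ | yes rest = record
    { partition = inj₂ (refl , refl , split-off j∈B , split-off-disjoint j B)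
    ; leftRect = (i , i∈A) , (j , x∈⁅x⁆ j) ; rightRect = (i , i∈A) , rest }
  ... | no rowsLeft | no colsLeft = ⊥-elim (¬mono (z , cell-colour))
    where
    z : Fin nz
    z = proj₁ (total i j)
    cell-colour : ∀ x y → x ∈ A → y ∈ B → (x , y , z) ∈T T
    cell-colour x y x∈A y∈B rewrite only-element rowsLeft x∈A | only-element colsLeft y∈B = proj₂ (total i j)

  leaves-pos : (t : RecPart R) → 1 ≤ leaves t
  leaves-pos (leaf _) = ≤-refl
  leaves-pos (node _ _ _ t u) = ≤-trans (leaves-pos t) (m≤m+n _ _)

  splitsOf : Rect → List Rect3
  splitsOf R = filter (λ g → rectDec (root g) R) Γ

  splitsOf⇒branch : ∀ {g} → g ∈ᴸ splitsOf R → IsBranch g × root g ≡ R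
  splitsOf⇒branch g∈splits =
    let (g∈Γ , root≡R) = ∈-filter⁻ (λ g → rectDec (root g) _) {xs = Γ} g∈splits in Γ⇒branch g∈Γ , root≡R

  orient∈splitsOf : ∀ {V W} (p : IsPartition R V W) (isV : IsRect V) → IsRect R → IsRect W →
                    Orientation.branch (orient p isV) ∈ᴸ splitsOf R
  orient∈splitsOf p isV isR isW =
    ∈-filter⁺ (λ g → rectDec (root g) _) (branch∈Γ (orient-isBranch p isV isR isW))
      (arranges-root (Orientation.ordering (orient p isV)))

  -- opt n R: the fewest leaves of a recursive partition of R into monochromatic
  -- rectangles, by dynamic programming over splitsOf R with recursion depth n
  -- (exact once size R < n, since children are smaller).
  opt : ℕ → Rect → ℕ
  optBy : ℕ → (R : Rect) → Dec (Mono R) → ℕ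
  splitCost : ℕ → Rect3 → ℕ

  opt zero R = 1
  opt (suc n) R = optBy n R (mono? R)
  optBy n R (yes _) = 1
  optBy n R (no _) = cheapest (splitCost n) (splitsOf R)
  splitCost n g = opt n (left g) + opt n (right g)

  opt-minimal : ∀ n → IsRect R → size R < n → (t : RecPart R) → opt n R ≤ leaves t
  opt-minimal {R} (suc n) isR size<n t = by-cases (mono? R) t
    where
    by-cases : (d : Dec (Mono R)) (t : RecPart R) → optBy n R d ≤ leaves t
    by-cases (yes _) t = leaves-pos t
    by-cases (no ¬mono) (leaf mono) = ⊥-elim (¬mono mono)
    by-cases (no _) (node {V = V} {W} isV isW p tV tW) = begin
      cheapest (splitCost n) (splitsOf R)  ≤⟨ cheapest-≤ (splitCost n) (orient∈splitsOf p isV isR isW) ⟩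
      splitCost n (Orientation.branch o)   ≡⟨ arranges-children (Orientation.ordering o) (opt n) ⟩
      opt n V + opt n W                    ≤⟨ +-mono-≤ (opt-minimal n isV (child<n p isW) tV)
                                                       (opt-minimal n isW (child<n (part-swap p) isV) tW) ⟩
      leaves tV + leaves tW                ∎
      where
      open ≤-Reasoning
      o : Orientation R V W
      o = orient p isV
      child<n : ∀ {V W} → IsPartition R V W → IsRect W → size V < n
      child<n p isW = ≤-trans (child-smaller p isW) (s≤s⁻¹ size<n)

  opt-attained : Total → ∀ n → IsRect R → size R < n → Σ (RecPart R) λ t → leaves t ≡ opt n R
  opt-attained {R} total (suc n) isR size<n = by-cases (mono? R)
    where
    by-cases : (d : Dec (Mono R)) → Σ (RecPart R) λ t → leaves t ≡ optBy n R d
    by-cases (yes mono) = leaf mono , refl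
    by-cases (no ¬mono) =
      let module S = Split (split total isR ¬mono)
          (g , g∈splits , cost≡) = cheapest-attained (splitCost n) (orient∈splitsOf S.partition S.leftRect isR S.rightRect)
          (t , leaves≡) = optimal-split g g∈splits
      in t , trans leaves≡ cost≡
      where
      optimal-split : ∀ g → g ∈ᴸ splitsOf R → Σ (RecPart R) λ t → leaves t ≡ splitCost n g
      optimal-split (R′ , V , W) g∈splits with splitsOf⇒branch g∈splits
      ... | b , refl =
        let open IsBranch b
            (tV , leavesV) = opt-attained total n leftRect (≤-trans (child-smaller partition rightRect) (s≤s⁻¹ size<n))
            (tW , leavesW) = opt-attained total n rightRect (≤-trans (child-smaller (part-swap partition) leftRect) (s≤s⁻¹ size<n))
        in node leftRect rightRect partition tV tW , cong₂ _+_ leavesV leavesW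

  -- Cᴾ R: the protocol partition number of R (opt with enough depth for every rectangle)
  Cᴾ : Rect → ℕ
  Cᴾ = opt (suc (nx + ny))

  Cᴾ-minimal : IsRect R → (t : RecPart R) → Cᴾ R ≤ leaves t
  Cᴾ-minimal {R} isR = opt-minimal _ isR (s≤s (size-≤ R))

  Cᴾ-attained : Total → IsRect R → Σ (RecPart R) λ t → leaves t ≡ Cᴾ R
  Cᴾ-attained {R} total isR = opt-attained total _ isR (s≤s (size-≤ R))

  Cᴾ-mono : Mono R → Cᴾ R ≡ 1
  Cᴾ-mono {R} mono with mono? R
  ... | yes _ = refl
  ... | no ¬mono = ⊥-elim (¬mono mono)

  -- combining optimal partitions of the two parts partitions the whole
  Cᴾ-subadditive : Total → ∀ {g} → IsBranch g → Cᴾ (root g) ≤ Cᴾ (left g) + Cᴾ (right g)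
  Cᴾ-subadditive total {g} b =
    let open IsBranch b
        (tV , leavesV) = Cᴾ-attained total leftRect
        (tW , leavesW) = Cᴾ-attained total rightRect
    in subst (Cᴾ (root g) ≤_) (cong₂ _+_ leavesV leavesW) (Cᴾ-minimal rootRect (node leftRect rightRect partition tV tW))

module FromTree {nx ny nz : ℕ} (T : Rel3 nx ny nz) where
  open PN T
  open Rectangles T

  private variable R S : Rect

  -- The solution of PN(T) read off a recursive partition t of R: x counts the
  -- leaves of t equal to S, y counts the internal nodes of t represented by g.
  xOf : RecPart R → Rect → ℕ
  xOf {R} (leaf _) S = when (rectDec S R) 1
  xOf (node _ _ _ t u) S = xOf t S + xOf u S

  yOf : RecPart R → Rect3 → ℕ
  yOf (leaf _) g = 0
  yOf (node isV _ p t u) g = when (rect3Dec g (Orientation.branch (orient p isV))) 1 + yOf t g + yOf u g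

  xOf-cover : IsRect R → (t : RecPart R) → ∀ c → ∑ monoRects (λ S → when (c ∈R? S) (xOf t S)) ≡ when (c ∈R? R) 1
  xOf-cover {R} isR (leaf mono) c =
    trans (∑-ext monoRects (λ S _ → when-comm (c ∈R? S) (rectDec S R) 1)) (once-monoRects isR mono (λ S → rectDec S R) _)
  xOf-cover isR (node isV isW p t u) c =
    trans (∑-when-+ (c ∈R?_) monoRects (xOf t) (xOf u))
          (trans (cong₂ _+_ (xOf-cover isV t c) (xOf-cover isW u c)) (cell-additive p c 1))

  xOf-objective : IsRect R → (t : RecPart R) → ∑ monoRects (xOf t) ≡ leaves t
  xOf-objective {R} isR (leaf mono) = once-monoRects isR mono (λ S → rectDec S R) (λ _ → 1)
  xOf-objective isR (node isV isW p t u) = trans (∑-+ monoRects _ _) (cong₂ _+_ (xOf-objective isV t) (xOf-objective isW u))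

  xOf-nonmono : (t : RecPart R) → ¬ Mono S → xOf t S ≡ 0
  xOf-nonmono {R} {S} (leaf mono) ¬mono = when-no (rectDec S R) (λ { refl → ¬mono mono })
  xOf-nonmono (node _ _ _ t u) ¬mono = cong₂ _+_ (xOf-nonmono t ¬mono) (xOf-nonmono u ¬mono)

  restrict-point : ∀ {g₀} → IsBranch g₀ → {P : Rect3 → Set} (P? : ∀ g → Dec (P g)) (a b : Rect3 → ℕ) →
                   ∑ Γ (λ g → when (P? g) (when (rect3Dec g g₀) 1 + a g + b g)) ≡
                   when (P? g₀) 1 + ∑ Γ (λ g → when (P? g) (a g)) + ∑ Γ (λ g → when (P? g) (b g))
  restrict-point {g₀} b₀ P? a b = begin
    ∑ Γ (λ g → when (P? g) (when (rect3Dec g g₀) 1 + a g + b g))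
      ≡⟨ ∑-when-+ P? Γ _ b ⟩
    ∑ Γ (λ g → when (P? g) (when (rect3Dec g g₀) 1 + a g)) + ∑ Γ (λ g → when (P? g) (b g))
      ≡⟨ cong (_+ ∑ Γ (λ g → when (P? g) (b g))) (∑-when-+ P? Γ _ a) ⟩
    ∑ Γ (λ g → when (P? g) (when (rect3Dec g g₀) 1)) + ∑ Γ (λ g → when (P? g) (a g)) + ∑ Γ (λ g → when (P? g) (b g))
      ≡⟨ cong (λ z → z + ∑ Γ (λ g → when (P? g) (a g)) + ∑ Γ (λ g → when (P? g) (b g))) point ⟩
    when (P? g₀) 1 + ∑ Γ (λ g → when (P? g) (a g)) + ∑ Γ (λ g → when (P? g) (b g)) ∎
    where
    open ≡-Reasoning
    point : ∑ Γ (λ g → when (P? g) (when (rect3Dec g g₀) 1)) ≡ when (P? g₀) 1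
    point = trans (∑-ext Γ (λ g _ → when-comm (P? g) (rect3Dec g g₀) 1)) (once-Γ b₀ (λ g → rect3Dec g g₀) _)

  -- Conservation along the tree: besides the flow through the internal nodes,
  -- the root R receives one unit and every leaf emits one unit.
  tree-flow : IsRect R → (t : RecPart R) → ∀ S → inflow (yOf t) S + when (rectDec S R) 1 ≡ outflow (yOf t) S + xOf t S
  tree-flow {R} isR (leaf _) S =
    cong (_+ when (rectDec S R) 1) (trans (∑-zero Γ (λ g → when-0 (child? S g))) (sym (∑-zero Γ (λ g → when-0 (rectDec (root g) S)))))
  tree-flow {R} isR (node {V = V} {W} isV isW p t u) S = begin
    inflow (yOf (node isV isW p t u)) S + [S≡ R ]
      ≡⟨ cong (_+ [S≡ R ]) (restrict-point b₀ (child? S) (yOf t) (yOf u)) ⟩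
    when (child? S g₀) 1 + inflow (yOf t) S + inflow (yOf u) S + [S≡ R ]
      ≡⟨ cong (λ z → z + inflow (yOf t) S + inflow (yOf u) S + [S≡ R ]) (arranges-child? (Orientation.ordering o) (children-distinct p isV) S 1) ⟩
    [S≡ V ] + [S≡ W ] + inflow (yOf t) S + inflow (yOf u) S + [S≡ R ]
      ≡⟨ rearrange [S≡ V ] [S≡ W ] (inflow (yOf t) S) (inflow (yOf u) S) [S≡ R ] (outflow (yOf t) S) (outflow (yOf u) S) (xOf t S) (xOf u S)
           (tree-flow isV t S) (tree-flow isW u S) ⟩
    [S≡ R ] + outflow (yOf t) S + outflow (yOf u) S + (xOf t S + xOf u S)
      ≡⟨ cong (λ z → z + outflow (yOf t) S + outflow (yOf u) S + (xOf t S + xOf u S)) root-term ⟨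
    when (rectDec (root g₀) S) 1 + outflow (yOf t) S + outflow (yOf u) S + (xOf t S + xOf u S)
      ≡⟨ cong (_+ (xOf t S + xOf u S)) (restrict-point b₀ (λ g → rectDec (root g) S) (yOf t) (yOf u)) ⟨
    outflow (yOf (node isV isW p t u)) S + (xOf t S + xOf u S) ∎
    where
    open ≡-Reasoning
    [S≡_] : Rect → ℕ
    [S≡ X ] = when (rectDec S X) 1
    o : Orientation R V W
    o = orient p isV
    g₀ : Rect3
    g₀ = Orientation.branch o
    b₀ : IsBranch g₀
    b₀ = orient-isBranch p isV isR isW
    root-term : when (rectDec (root g₀) S) 1 ≡ [S≡ R ]
    root-term = when-cong (rectDec (root g₀) S) (rectDec S R) (λ e → trans (sym e) root≡R) (λ e → trans root≡R (sym e))
      where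
      root≡R : root g₀ ≡ R
      root≡R = arranges-root (Orientation.ordering o)
    rearrange : ∀ v w it iu r ot ou xt xu → it + v ≡ ot + xt → iu + w ≡ ou + xu →
                v + w + it + iu + r ≡ r + ot + ou + (xt + xu)
    rearrange v w it iu r ot ou xt xu flow-t flow-u = begin
      v + w + it + iu + r        ≡⟨ regroup-in v w it iu r ⟩
      (it + v) + (iu + w) + r    ≡⟨ cong₂ (λ a b → a + b + r) flow-t flow-u ⟩
      (ot + xt) + (ou + xu) + r  ≡⟨ regroup-out ot xt ou xu r ⟩
      r + ot + ou + (xt + xu)    ∎
      where
      regroup-in : ∀ v w it iu r → v + w + it + iu + r ≡ (it + v) + (iu + w) + r
      regroup-in = solve-∀
      regroup-out : ∀ ot xt ou xu r → (ot + xt) + (ou + xu) + r ≡ r + ot + ou + (xt + xu)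
      regroup-out = solve-∀

  tree-feasible : IsRect full → (t : RecPart full) → Feasible (xOf t) (yOf t)
  tree-feasible isFull t = cover , λ S _ S≢full → (λ _ → balance S S≢full) , balance-nonmono S S≢full
    where
    cover : ∀ c → sumWhere (c ∈R?_) monoRects (xOf t) ≡ 1
    cover c = trans (sumWhere-∑ (c ∈R?_) monoRects (xOf t)) (trans (xOf-cover isFull t c) (when-yes (c ∈R? full) (∈⊤ , ∈⊤)))
    out : Rect → ℕ
    out S = sumWhere (λ g → rectDec (root g) S) Γ (yOf t)
    balance : ∀ S → S ≢ full → sumWhere (child? S) Γ (yOf t) ≡ out S + xOf t S
    balance S S≢full = begin
      sumWhere (child? S) Γ (yOf t)                  ≡⟨ sumWhere-∑ (child? S) Γ (yOf t) ⟩
      inflow (yOf t) S                               ≡⟨ +-identityʳ _ ⟨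
      inflow (yOf t) S + 0                           ≡⟨ cong (inflow (yOf t) S +_) (when-no (rectDec S full) S≢full) ⟨
      inflow (yOf t) S + when (rectDec S full) 1     ≡⟨ tree-flow isFull t S ⟩
      outflow (yOf t) S + xOf t S                    ≡⟨ cong (_+ xOf t S) (sumWhere-∑ (λ g → rectDec (root g) S) Γ (yOf t)) ⟨
      out S + xOf t S                                ∎
      where open ≡-Reasoning
    balance-nonmono : ∀ S → S ≢ full → ¬ Mono S → sumWhere (child? S) Γ (yOf t) ≡ out S
    balance-nonmono S S≢full ¬mono = trans (balance S S≢full) (trans (cong (out S +_) (xOf-nonmono t ¬mono)) (+-identityʳ _))

module LowerBound {nx ny nz : ℕ} (T : Rel3 nx ny nz) where
  open PN T
  open Rectangles T
  open Protocol T

  proper? : (S : Rect) → Dec (S ≢ full)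
  proper? S = ¬? (rectDec S full)

  module _ (x : Rect → ℕ) (y : Rect3 → ℕ) (feasible : Feasible x y) where

    xᴹ : Rect → ℕ
    xᴹ S = when (mono? S) (x S)

    conservation : ∀ S → S ∈ᴸ rects → when (proper? S) (inflow y S) ≡ when (proper? S) (outflow y S + xᴹ S)
    conservation S S∈rects with proper? S
    ... | no _ = refl
    ... | yes S≢full with proj₂ feasible S (rects⇒rect S∈rects) S≢full | mono? S
    ...   | (balanced , _) | yes mono = begin
      inflow y S                                         ≡⟨ sumWhere-∑ (child? S) Γ y ⟨
      sumWhere (child? S) Γ y                            ≡⟨ balanced mono ⟩
      sumWhere (λ g → rectDec (root g) S) Γ y + x S      ≡⟨ cong (_+ x S) (sumWhere-∑ (λ g → rectDec (root g) S) Γ y) ⟩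
      outflow y S + x S                                  ∎
      where open ≡-Reasoning
    ...   | (_ , balanced) | no ¬mono = begin
      inflow y S                                         ≡⟨ sumWhere-∑ (child? S) Γ y ⟨
      sumWhere (child? S) Γ y                            ≡⟨ balanced ¬mono ⟩
      sumWhere (λ g → rectDec (root g) S) Γ y            ≡⟨ sumWhere-∑ (λ g → rectDec (root g) S) Γ y ⟩
      outflow y S                                        ≡⟨ +-identityʳ _ ⟨
      outflow y S + 0                                    ∎
      where open ≡-Reasoning

    exchange-sums : {Q : Rect → Rect3 → Set} (Q? : ∀ S g → Dec (Q S g)) (w : Rect → ℕ) →
                  ∑ rects (λ S → when (proper? S) (w S * ∑ Γ (λ g → when (Q? S g) (y g)))) ≡
                  ∑ Γ (λ g → y g * ∑ rects (λ S → when (proper? S) (when (Q? S g) (w S))))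
    exchange-sums Q? w = begin
      ∑ rects (λ S → when (proper? S) (w S * ∑ Γ (λ g → when (Q? S g) (y g))))
        ≡⟨ ∑-ext rects (λ S _ → inner S) ⟩
      ∑ rects (λ S → ∑ Γ (λ g → y g * when (proper? S) (when (Q? S g) (w S))))
        ≡⟨ ∑-swap rects Γ _ ⟩
      ∑ Γ (λ g → ∑ rects (λ S → y g * when (proper? S) (when (Q? S g) (w S))))
        ≡⟨ ∑-ext Γ (λ g _ → ∑-*ˡ rects (y g) _) ⟩
      ∑ Γ (λ g → y g * ∑ rects (λ S → when (proper? S) (when (Q? S g) (w S)))) ∎
      where
      open ≡-Reasoning
      term : ∀ S g → w S * when (Q? S g) (y g) ≡ y g * when (Q? S g) (w S)
      term S g = trans (when-* (Q? S g) (w S) (y g))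
                   (trans (cong (when (Q? S g)) (*-comm (w S) (y g))) (sym (when-* (Q? S g) (y g) (w S))))
      inner : ∀ S → when (proper? S) (w S * ∑ Γ (λ g → when (Q? S g) (y g))) ≡
                    ∑ Γ (λ g → y g * when (proper? S) (when (Q? S g) (w S)))
      inner S = begin
        when (proper? S) (w S * ∑ Γ (λ g → when (Q? S g) (y g)))      ≡⟨ cong (when (proper? S)) (∑-*ˡ Γ (w S) _) ⟨
        when (proper? S) (∑ Γ (λ g → w S * when (Q? S g) (y g)))      ≡⟨ when-∑ (proper? S) Γ _ ⟩
        ∑ Γ (λ g → when (proper? S) (w S * when (Q? S g) (y g)))      ≡⟨ ∑-ext Γ (λ g _ → cong (when (proper? S)) (term S g)) ⟩
        ∑ Γ (λ g → when (proper? S) (y g * when (Q? S g) (w S)))      ≡⟨ ∑-ext Γ (λ g _ → when-* (proper? S) (y g) _) ⟨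
        ∑ Γ (λ g → y g * when (proper? S) (when (Q? S g) (w S)))      ∎

    -- the children of an element of Γ are two distinct proper rectangles
    children-weight : (w : Rect → ℕ) → ∀ {g} → IsBranch g →
                      ∑ rects (λ S → when (proper? S) (when (child? S g) (w S))) ≡ w (left g) + w (right g)
    children-weight w {g} b = begin
      ∑ rects (λ S → when (proper? S) (when (child? S g) (w S)))
        ≡⟨ ∑-ext rects (λ S _ → cong (when (proper? S)) (child?-split {g} (children-distinct partition leftRect) S (w S))) ⟩
      ∑ rects (λ S → when (proper? S) (when (rectDec S (left g)) (w S) + when (rectDec S (right g)) (w S)))
        ≡⟨ ∑-when-+ proper? rects _ _ ⟩
      ∑ rects (λ S → when (proper? S) (when (rectDec S (left g)) (w S))) + ∑ rects (λ S → when (proper? S) (when (rectDec S (right g)) (w S)))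
        ≡⟨ cong₂ _+_ (pick leftRect (child-proper partition rightRect)) (pick rightRect (child-proper (part-swap partition) leftRect)) ⟩
      w (left g) + w (right g) ∎
      where
      open ≡-Reasoning
      open IsBranch b
      pick : ∀ {V} → IsRect V → V ≢ full → ∑ rects (λ S → when (proper? S) (when (rectDec S V) (w S))) ≡ w V
      pick {V} isV V≢full =
        trans (∑-ext rects (λ S _ → when-comm (proper? S) (rectDec S V) (w S)))
              (trans (once-rects isV (λ S → rectDec S V) (λ S → when (proper? S) (w S))) (when-yes (proper? V) V≢full))

    root-weight : (w : Rect → ℕ) → ∀ {g} → IsBranch g →
                  ∑ rects (λ S → when (proper? S) (when (rectDec (root g) S) (w S))) ≡ when (proper? (root g)) (w (root g))
    root-weight w {g} b =
      trans (∑-ext rects (λ S _ → trans (cong (when (proper? S)) (when-cong (rectDec (root g) S) (rectDec S (root g)) sym sym))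
                                         (when-comm (proper? S) (rectDec S (root g)) (w S))))
            (once-rects (IsBranch.rootRect b) (λ S → rectDec S (root g)) (λ S → when (proper? S) (w S)))

    leafWeight rootWeight properRootWeight childWeight : (Rect → ℕ) → ℕ
    leafWeight w = ∑ rects (λ S → when (proper? S) (w S * xᴹ S))
    rootWeight w = ∑ Γ (λ g → y g * w (root g))
    properRootWeight w = ∑ Γ (λ g → when (proper? (root g)) (y g * w (root g)))
    childWeight w = ∑ Γ (λ g → y g * (w (left g) + w (right g)))

    inflow-total : ∀ w → ∑ rects (λ S → when (proper? S) (w S * inflow y S)) ≡ childWeight w
    inflow-total w = trans (exchange-sums child? w)
      (∑-ext Γ (λ g g∈Γ → cong (y g *_) (children-weight w (Γ⇒branch g∈Γ))))

    outflow-total : ∀ w → ∑ rects (λ S → when (proper? S) (w S * outflow y S)) ≡ properRootWeight w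
    outflow-total w = trans (exchange-sums (λ S g → rectDec (root g) S) w)
      (∑-ext Γ (λ g g∈Γ → trans (cong (y g *_) (root-weight w (Γ⇒branch g∈Γ))) (when-* (proper? (root g)) (y g) _)))

    conservation-total : ∀ w → ∑ rects (λ S → when (proper? S) (w S * inflow y S)) ≡
                               ∑ rects (λ S → when (proper? S) (w S * outflow y S)) + leafWeight w
    conservation-total w = trans (∑-ext rects pointwise) (∑-+ rects _ _)
      where
      open ≡-Reasoning
      pointwise : ∀ S → S ∈ᴸ rects → when (proper? S) (w S * inflow y S) ≡
                                      when (proper? S) (w S * outflow y S) + when (proper? S) (w S * xᴹ S)
      pointwise S S∈rects = begin
        when (proper? S) (w S * inflow y S)                   ≡⟨ when-* (proper? S) (w S) _ ⟨
        w S * when (proper? S) (inflow y S)                   ≡⟨ cong (w S *_) (conservation S S∈rects) ⟩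
        w S * when (proper? S) (outflow y S + xᴹ S)           ≡⟨ cong (w S *_) (when-+ (proper? S) _ _) ⟩
        w S * (when (proper? S) (outflow y S) + when (proper? S) (xᴹ S))
                                                              ≡⟨ *-distribˡ-+ (w S) _ _ ⟩
        w S * when (proper? S) (outflow y S) + w S * when (proper? S) (xᴹ S)
                                                              ≡⟨ cong₂ _+_ (when-* (proper? S) (w S) _) (when-* (proper? S) (w S) _) ⟩
        when (proper? S) (w S * outflow y S) + when (proper? S) (w S * xᴹ S) ∎

    root-split : ∀ w → rootWeight w ≡ properRootWeight w + w full * outflow y full
    root-split w = begin
      ∑ Γ (λ g → y g * w (root g))
        ≡⟨ ∑-ext Γ (λ g _ → by-cases g (rectDec (root g) full)) ⟩
      ∑ Γ (λ g → when (proper? (root g)) (y g * w (root g)) + when (rectDec (root g) full) (w full * y g))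
        ≡⟨ ∑-+ Γ _ _ ⟩
      properRootWeight w + ∑ Γ (λ g → when (rectDec (root g) full) (w full * y g))
        ≡⟨ cong (properRootWeight w +_) (trans (∑-ext Γ (λ g _ → sym (when-* (rectDec (root g) full) (w full) (y g)))) (∑-*ˡ Γ (w full) _)) ⟩
      properRootWeight w + w full * outflow y full ∎
      where
      open ≡-Reasoning
      by-cases : ∀ g (d : Dec (root g ≡ full)) → y g * w (root g) ≡ when (¬? d) (y g * w (root g)) + when d (w full * y g)
      by-cases g (yes root≡full) = trans (cong (λ R → y g * w R) root≡full) (*-comm (y g) (w full))
      by-cases g (no _) = sym (+-identityʳ _)

    balance : ∀ w → rootWeight w + leafWeight w ≡ childWeight w + w full * outflow y full
    balance w = begin
      rootWeight w + leafWeight w                                         ≡⟨ cong (_+ leafWeight w) (root-split w) ⟩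
      properRootWeight w + w full * outflow y full + leafWeight w         ≡⟨ xy∙z≈xz∙y (properRootWeight w) _ _ ⟩
      properRootWeight w + leafWeight w + w full * outflow y full         ≡⟨ cong (λ z → z + leafWeight w + w full * outflow y full) (outflow-total w) ⟨
      ∑ rects (λ S → when (proper? S) (w S * outflow y S)) + leafWeight w + w full * outflow y full
                                                                          ≡⟨ cong (_+ w full * outflow y full) (conservation-total w) ⟨
      ∑ rects (λ S → when (proper? S) (w S * inflow y S)) + w full * outflow y full
                                                                          ≡⟨ cong (_+ w full * outflow y full) (inflow-total w) ⟩
      childWeight w + w full * outflow y full                             ∎
      where open ≡-Reasoning

    subadditive-bound : (w : Rect → ℕ) → (∀ {g} → IsBranch g → w (root g) ≤ w (left g) + w (right g)) →
                        w full * outflow y full ≤ leafWeight w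
    subadditive-bound w subadditive = +-cancelˡ-≤ (childWeight w) _ _ (begin
      childWeight w + w full * outflow y full   ≡⟨ balance w ⟨
      rootWeight w + leafWeight w               ≤⟨ +-monoˡ-≤ (leafWeight w) roots≤children ⟩
      childWeight w + leafWeight w              ∎)
      where
      open ≤-Reasoning
      roots≤children : rootWeight w ≤ childWeight w
      roots≤children = ∑-mono Γ (λ g g∈Γ → *-monoʳ-≤ (y g) (subadditive (Γ⇒branch g∈Γ)))

    additive-exact : (w : Rect → ℕ) → (∀ {g} → IsBranch g → w (root g) ≡ w (left g) + w (right g)) →
                     w full * outflow y full ≡ leafWeight w
    additive-exact w additive = +-cancelˡ-≡ (childWeight w) _ _ (begin
      childWeight w + w full * outflow y full   ≡⟨ balance w ⟨
      rootWeight w + leafWeight w               ≡⟨ cong (_+ leafWeight w) roots≡children ⟩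
      childWeight w + leafWeight w              ∎)
      where
      open ≡-Reasoning
      roots≡children : rootWeight w ≡ childWeight w
      roots≡children = ∑-ext Γ (λ g g∈Γ → cong (y g *_) (additive (Γ⇒branch g∈Γ)))

    -- the weight Cᴾ is 1 on monochromatic rectangles, so its leaf weight is at most the objective
    Cᴾ-leafWeight : leafWeight Cᴾ ≤ objective x
    Cᴾ-leafWeight = begin
      ∑ rects (λ S → when (proper? S) (Cᴾ S * xᴹ S))  ≤⟨ ∑-mono rects (λ S _ → when-≤ (proper? S) _) ⟩
      ∑ rects (λ S → Cᴾ S * xᴹ S)                     ≡⟨ ∑-ext rects (λ S _ → unit-weight S (mono? S)) ⟩
      ∑ rects xᴹ                                      ≡⟨ sumWhere-∑ mono? rects x ⟨
      objective x                                     ∎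
      where
      open ≤-Reasoning
      unit-weight : ∀ S (d : Dec (Mono S)) → Cᴾ S * when d (x S) ≡ when d (x S)
      unit-weight S (yes mono) = trans (cong (_* x S) (Cᴾ-mono mono)) (*-identityˡ (x S))
      unit-weight S (no _) = *-zeroʳ (Cᴾ S)

    cell-cover : ∀ c → ∑ rects (λ S → when (mono? S) (when (c ∈R? S) (x S))) ≡ 1
    cell-cover c = trans (sym (trans (sumWhere-∑ (c ∈R?_) monoRects x) (sumWhere-∑ mono? rects _))) (proj₁ feasible c)

    -- if the whole matrix is not monochromatic, the weight "contains the cell c"
    -- (additive over partitions) shows that the whole matrix has outflow exactly 1
    full-outflow : Fin nx × Fin ny → ¬ Mono full → outflow y full ≡ 1
    full-outflow c ¬mono = begin
      outflow y full                      ≡⟨ *-identityˡ _ ⟨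
      1 * outflow y full                  ≡⟨ cong (_* outflow y full) (when-yes (c ∈R? full) (∈⊤ , ∈⊤)) ⟨
      cellWeight full * outflow y full    ≡⟨ additive-exact cellWeight (λ b → sym (cell-additive (IsBranch.partition b) c 1)) ⟩
      leafWeight cellWeight               ≡⟨ ∑-ext rects (λ S _ → pointwise S (mono? S)) ⟩
      ∑ rects (λ S → when (mono? S) (when (c ∈R? S) (x S)))   ≡⟨ cell-cover c ⟩
      1                                   ∎
      where
      open ≡-Reasoning
      cellWeight : Rect → ℕ
      cellWeight S = when (c ∈R? S) 1
      pointwise : ∀ S (d : Dec (Mono S)) → when (proper? S) (cellWeight S * when d (x S)) ≡ when d (when (c ∈R? S) (x S))
      pointwise S (no _) = trans (cong (when (proper? S)) (*-zeroʳ (cellWeight S))) (when-0 (proper? S))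
      pointwise S (yes mono) = trans (when-yes (proper? S) (λ { refl → ¬mono mono })) (when-1-* (c ∈R? S) (x S))

    pn-lower-bound : Total → Fin nx × Fin ny → Cᴾ full ≤ objective x
    pn-lower-bound total c = by-cases (mono? full)
      where
      by-cases : Dec (Mono full) → Cᴾ full ≤ objective x
      by-cases (yes mono) = begin
        Cᴾ full                                                ≡⟨ Cᴾ-mono mono ⟩
        1                                                      ≡⟨ cell-cover c ⟨
        ∑ rects (λ S → when (mono? S) (when (c ∈R? S) (x S)))  ≤⟨ ∑-mono rects (λ S _ → when-mono (mono? S) (when-≤ (c ∈R? S) (x S))) ⟩
        ∑ rects xᴹ                                             ≡⟨ sumWhere-∑ mono? rects x ⟨
        objective x                                            ∎
        where open ≤-Reasoning
      by-cases (no ¬mono) = begin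
        Cᴾ full                           ≡⟨ *-identityʳ _ ⟨
        Cᴾ full * 1                       ≡⟨ cong (Cᴾ full *_) (full-outflow c ¬mono) ⟨
        Cᴾ full * outflow y full          ≤⟨ subadditive-bound Cᴾ (Cᴾ-subadditive total) ⟩
        leafWeight Cᴾ                     ≤⟨ Cᴾ-leafWeight ⟩
        objective x                       ∎
        where open ≤-Reasoning

theorem3 : ∀ {nx ny nz : ℕ} (T : Rel3 nx ny nz) →
    Σ (Fin nx × Fin ny × Fin nz) (λ t → t ∈T T) →
    (∀ (x : Fin nx) (y : Fin ny) → Σ (Fin nz) λ z → (x , y , z) ∈T T) →
    Σ ℕ (λ k → PN.IsProtocolPartitionNumber T k × PN.IsOptimalValuePN T k)
theorem3 T ((i , j , _) , _) total =
  Cᴾ full ,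
  ((optimal , leaves≡Cᴾ) , Cᴾ-minimal isFull) ,
  ((xOf optimal , yOf optimal , tree-feasible isFull optimal , trans (xOf-objective isFull optimal) leaves≡Cᴾ) ,
   λ x y feasible → pn-lower-bound x y feasible total (i , j))
  where
  open PN T
  open Rectangles T
  open Protocol T
  open FromTree T
  open LowerBound T
  isFull : IsRect full
  isFull = (i , ∈⊤) , (j , ∈⊤)
  optimal : RecPart full
  optimal = proj₁ (Cᴾ-attained total isFull)
  leaves≡Cᴾ : leaves optimal ≡ Cᴾ full
  leaves≡Cᴾ = proj₂ (Cᴾ-attained total isFull)
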